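{- Let $n = \prod_{i=1}^N p_i$ where $N \ge 3$ and $p_1,\dots,p_N$ are distinct primes. Then $X(n) < 0$; in particular, $n$ is not a survivor.
   Context: For a positive integer $n$, let $\Pi(n)$ denote the sum of the distinct prime divisors of $n$, and let $\mathcal{C}(n)$ denote the sum of all positive divisors of $n$ that are not prime (including $1$ and, when $n$ is not prime, $n$ itself). Define $X(n) = \Pi(n) - \mathcal{C}(n) + n$. For $a\ge1$ let $X^{(a)}$ denote the $a$-fold iterate of $X$. A positive integer $n$ is a survivor if $X^{(a)}(n) > 0$ for all $a \ge 1$. -}

module Defs where

open import Data.Nat using (ℕ; zero; suc; _+_)
open import Data.Nat.Divisibility using (_∣_; _∣?_)
open import Data.Nat.Primality using (Prime; prime?)
open import Data.List using (List; filter; upTo; map)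
open import Data.Nat.ListAction using (sum)
open import Data.Integer as ℤ using (ℤ; +_; _-_; _>_)
open import Relation.Nullary using (¬_)
open import Relation.Nullary.Decidable using (¬?)

divisors : ℕ → List ℕ
divisors n = filter (_∣? n) (map suc (upTo n))

Π : ℕ → ℕ
Π n = sum (filter prime? (divisors n))

𝒞 : ℕ → ℕ
𝒞 n = sum (filter (λ d → ¬? (prime? d)) (divisors n))

X : ℕ → ℤ
X n = (+ Π n) - (+ 𝒞 n) ℤ.+ (+ n)

-- X extended to ℤ for iteration; the value on non-positive inputs is
-- irrelevant for survivorship (the first non-positive iterate already fails).
Xℤ : ℤ → ℤ
Xℤ (+ m) = X m
Xℤ z = z

Xiter : ℕ → ℕ → ℤ
Xiter zero n = + n
Xiter (suc a) n = Xℤ (Xiter a n)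

Survivor : ℕ → Set
Survivor n = (a : ℕ) → a Data.Nat.≥ 1 → Xiter a n > + 0

{-# OPTIONS --safe #-}
-- For n = p q r ⋯ with p ≠ q, the divisors 1, n, n/p and n/q are distinct and
-- not prime, so 𝒞(n) ≥ 1 + n + n/p + n/q. On the other hand Π(n) is at most the
-- sum of the prime factors; with Q = n/(p q) ≥ 2, the bound x + y ≤ x y for
-- x, y ≥ 2 gives p + q + (sum of the other factors) ≤ p + q + Q ≤ pQ + qQ
-- = n/q + n/p. Hence Π(n) + n < 𝒞(n), i.e. X(n) < 0 already at the first iterate.
module Submission where

open import Defs
open import Data.Nat using (ℕ; _≥_)
open import Data.List using (List; length)
open import Data.Nat.ListAction using (product)
open import Data.List.Relation.Unary.All using (All)
open import Data.List.Relation.Unary.Unique.Propositional using (Unique)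
open import Data.Nat.Primality using (Prime)
open import Data.Integer using (+_; _<_)
open import Data.Product using (_×_)
open import Relation.Nullary using (¬_)
open import Relation.Binary.PropositionalEquality using (_≡_)

import Data.Nat as ℕ
open import Data.Nat using (zero; suc; _+_; _*_; _≤_; z≤n; s≤s; NonZero; >-nonZero; ≢-nonZero⁻¹; nonTrivial⇒n>1)
open import Data.Nat.Properties
open import Data.Nat.Divisibility using (_∣_; _∣?_; ∣⇒≤; ∣-refl; 1∣_; 0∣⇒≡0; n∣m*n; m∣m*n; *-monoʳ-∣)
open import Data.Nat.Divisibility.Core using (hasNonTrivialDivisor)
open import Data.Nat.Primality using (prime?; ¬prime[1]; prime⇒nonTrivial; prime⇒nonZero; composite⇒¬prime; productOfPrimes≢0)
open import Data.Nat.Primality.Factorisation using (factorisationHasAllPrimeFactors)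
open import Data.Nat.ListAction using (sum)
open import Data.Nat.ListAction.Properties using (sum-↭)
open import Data.Nat.Tactic.RingSolver using (solve-∀)
open import Data.List using ([]; _∷_; [_]; _++_; filter; map; upTo)
import Data.List.Relation.Unary.All as All
open import Data.List.Relation.Unary.All using ([]; _∷_)
open import Data.List.Relation.Unary.AllPairs using ([]; _∷_)
open import Data.List.Relation.Unary.Any using (here; there)
open import Data.List.Relation.Unary.Unique.Propositional.Properties using (filter⁺; map⁺; upTo⁺)
open import Data.List.Membership.Propositional using (_∈_)
open import Data.List.Membership.Propositional.Properties using (∈-∃++; ∈-filter⁺; ∈-filter⁻; ∈-map⁺; ∈-upTo⁺)
open import Data.List.Relation.Binary.Subset.Propositional using (_⊆_)
open import Data.List.Relation.Binary.Permutation.Propositional.Properties using (shift; ∈-resp-↭)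
open import Data.Integer as ℤ using (_-_; +<+)
import Data.Integer.Properties as ℤ
import Data.Integer.Tactic.RingSolver as ℤ-Solver
open import Data.Product using (_,_; proj₂)
open import Function using (_∘_)
open import Relation.Nullary using (contradiction)
open import Relation.Nullary.Decidable using (¬?)
open import Relation.Binary.PropositionalEquality using (refl; sym; trans; cong; subst; _≢_)

sum-mono-⊆ : ∀ {xs ys : List ℕ} → Unique xs → xs ⊆ ys → sum xs ≤ sum ys
sum-mono-⊆ {[]} _ _ = z≤n
sum-mono-⊆ {x ∷ xs} (x∉xs ∷ xs-unique) xs⊆ys
  with as , bs , refl ← ∈-∃++ (xs⊆ys (here refl)) = begin
    x + sum xs             ≤⟨ +-monoʳ-≤ x (sum-mono-⊆ xs-unique xs⊆as++bs) ⟩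
    x + sum (as ++ bs)     ≡⟨ sum-↭ (shift x as bs) ⟨
    sum (as ++ [ x ] ++ bs) ∎
  where
  open ≤-Reasoning
  xs⊆as++bs : xs ⊆ as ++ bs
  xs⊆as++bs y∈xs with ∈-resp-↭ (shift x as bs) (xs⊆ys (there y∈xs))
  ... | here y≡x       = contradiction (sym y≡x) (All.lookup x∉xs y∈xs)
  ... | there y∈as++bs = y∈as++bs

+≤* : ∀ {m n} → 2 ≤ m → 2 ≤ n → m + n ≤ m * n
+≤* {suc (suc x)} {suc (suc y)} (s≤s (s≤s z≤n)) (s≤s (s≤s z≤n)) = begin
  (2 + x) + (2 + y)                         ≤⟨ m≤m+n _ (x + y + x * y) ⟩
  (2 + x) + (2 + y) + (x + y + x * y)       ≡⟨ expand x y ⟩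
  (2 + x) * (2 + y)                         ∎
  where
  open ≤-Reasoning
  expand : ∀ x y → (2 + x) + (2 + y) + (x + y + x * y) ≡ (2 + x) * (2 + y)
  expand = solve-∀

2≤product : ∀ {n ns} → All (2 ≤_) (n ∷ ns) → 2 ≤ product (n ∷ ns)
2≤product {n} (2≤n ∷ []) = ≤-trans 2≤n (m≤m*n n 1)
2≤product {n} (2≤n ∷ 2≤ns@(_ ∷ _)) =
  ≤-trans 2≤n (m≤m*n n _ {{>-nonZero (≤-trans (s≤s z≤n) (2≤product 2≤ns))}})

sum≤product : ∀ {ns} → All (2 ≤_) ns → sum ns ≤ product ns
sum≤product [] = z≤n
sum≤product {n ∷ []} (_ ∷ []) = ≤-reflexive (trans (+-identityʳ n) (sym (*-identityʳ n)))
sum≤product {n ∷ ns} (2≤n ∷ 2≤ns@(_ ∷ _)) =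
  ≤-trans (+-monoʳ-≤ n (sum≤product 2≤ns)) (+≤* 2≤n (2≤product 2≤ns))

m<n*m : ∀ m n .{{_ : NonZero m}} → 1 ℕ.< n → m ℕ.< n * m
m<n*m m n 1<n = subst (m ℕ.<_) (*-comm m n) (m<m*n m n 1<n)

prime⇒2≤ : ∀ {p} → Prime p → 2 ≤ p
prime⇒2≤ {p} p-prime = nonTrivial⇒n>1 p {{prime⇒nonTrivial p-prime}}

¬prime-* : ∀ {m n} → 2 ≤ m → 2 ≤ n → ¬ Prime (m * n)
¬prime-* {m@(suc (suc _))} {n} (s≤s (s≤s z≤n)) 2≤n =
  composite⇒¬prime (hasNonTrivialDivisor (m<m*n m n 2≤n) (m∣m*n n))

divisors-unique : ∀ n → Unique (divisors n)
divisors-unique n = filter⁺ (_∣? n) (map⁺ suc-injective (upTo⁺ n))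

∈-divisors⁺ : ∀ {d n} .{{_ : NonZero n}} → d ∣ n → d ∈ divisors n
∈-divisors⁺ {zero}  {n} 0∣n = contradiction (0∣⇒≡0 0∣n) (≢-nonZero⁻¹ n)
∈-divisors⁺ {suc _} {n} d∣n = ∈-filter⁺ (_∣? n) (∈-map⁺ suc (∈-upTo⁺ (∣⇒≤ d∣n))) d∣n

∈-divisors⁻ : ∀ {d n} → d ∈ divisors n → d ∣ n
∈-divisors⁻ {n = n} = proj₂ ∘ ∈-filter⁻ (_∣? n) {xs = map suc (upTo n)}

Π-product≤sum : ∀ {ps} → All Prime ps → Π (product ps) ≤ sum ps
Π-product≤sum {ps} ps-prime =
  sum-mono-⊆ (filter⁺ prime? (divisors-unique (product ps))) primeDivisors⊆ps
  where
  primeDivisors⊆ps : filter prime? (divisors (product ps)) ⊆ ps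
  primeDivisors⊆ps d∈ with d∈divisors , d-prime ← ∈-filter⁻ prime? {xs = divisors (product ps)} d∈ =
    factorisationHasAllPrimeFactors d-prime (∈-divisors⁻ d∈divisors) ps-prime

sum≤𝒞 : ∀ {n ds} .{{_ : NonZero n}} → Unique ds → All (λ d → d ∣ n × ¬ Prime d) ds → sum ds ≤ 𝒞 n
sum≤𝒞 ds-unique ds-nonPrimeDivisors = sum-mono-⊆ ds-unique λ d∈ds →
  let d∣n , d-nonPrime = All.lookup ds-nonPrimeDivisors d∈ds
  in ∈-filter⁺ (¬? ∘ prime?) (∈-divisors⁺ d∣n) d-nonPrime

Π+n<𝒞 : ∀ {p q r rs} → All Prime (p ∷ q ∷ r ∷ rs) → p ≢ q →
        let n = product (p ∷ q ∷ r ∷ rs) in Π n + n ℕ.< 𝒞 n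
Π+n<𝒞 {p} {q} {r} {rs} ps-prime@(p-prime ∷ q-prime ∷ rrs-prime) p≢q = begin-strict
  Π n + n                     ≤⟨ +-monoˡ-≤ n (Π-product≤sum ps-prime) ⟩
  p + (q + sum (r ∷ rs)) + n  ≤⟨ +-monoˡ-≤ n (+-monoʳ-≤ p (+-monoʳ-≤ q (sum≤product rrs≥2))) ⟩
  p + (q + Q) + n             ≤⟨ +-monoˡ-≤ n (+-monoˡ-≤ (q + Q) (m≤m+n p Q)) ⟩
  (p + Q) + (q + Q) + n       ≤⟨ +-monoˡ-≤ n (+-mono-≤ (+≤* 2≤p 2≤Q) (+≤* 2≤q 2≤Q)) ⟩
  p * Q + q * Q + n           <⟨ n<1+n _ ⟩
  suc (p * Q + q * Q + n)     ≡⟨ reorder (p * Q) (q * Q) n ⟩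
  sum ds                      ≤⟨ sum≤𝒞 ds-unique ds-nonPrimeDivisors ⟩
  𝒞 n                         ∎
  where
  open ≤-Reasoning
  Q n : ℕ
  Q = product (r ∷ rs)
  n = p * (q * Q)
  ds : List ℕ
  ds = 1 ∷ n ∷ p * Q ∷ q * Q ∷ []
  instance
    _ = prime⇒nonZero p-prime
    _ = productOfPrimes≢0 rrs-prime
    _ = productOfPrimes≢0 (q-prime ∷ rrs-prime)
    _ = productOfPrimes≢0 ps-prime
  rrs≥2 : All (2 ≤_) (r ∷ rs)
  rrs≥2 = All.map prime⇒2≤ rrs-prime
  2≤p : 2 ≤ p
  2≤p = prime⇒2≤ p-prime
  2≤q : 2 ≤ q
  2≤q = prime⇒2≤ q-prime
  2≤Q : 2 ≤ Q
  2≤Q = 2≤product rrs≥2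
  2≤pQ : 2 ≤ p * Q
  2≤pQ = ≤-trans 2≤p (m≤m*n p Q)
  2≤qQ : 2 ≤ q * Q
  2≤qQ = ≤-trans 2≤q (m≤m*n q Q)
  reorder : ∀ a b n → suc (a + b + n) ≡ 1 + (n + (a + (b + 0)))
  reorder = solve-∀
  qQ<n : q * Q ℕ.< n
  qQ<n = m<n*m (q * Q) p 2≤p
  pQ<n : p * Q ℕ.< n
  pQ<n = *-monoʳ-< p (m<n*m Q q 2≤q)
  ds-unique : Unique ds
  ds-unique = (<⇒≢ (<-trans 2≤qQ qQ<n) ∷ <⇒≢ 2≤pQ ∷ <⇒≢ 2≤qQ ∷ [])
            ∷ (>⇒≢ pQ<n ∷ >⇒≢ qQ<n ∷ [])
            ∷ ((λ pQ≡qQ → p≢q (*-cancelʳ-≡ p q Q pQ≡qQ)) ∷ [])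
            ∷ [] ∷ []
  ds-nonPrimeDivisors : All (λ d → d ∣ n × ¬ Prime d) ds
  ds-nonPrimeDivisors = (1∣ n , ¬prime[1])
                      ∷ (∣-refl , ¬prime-* 2≤p 2≤qQ)
                      ∷ (*-monoʳ-∣ p (n∣m*n q) , ¬prime-* 2≤p 2≤Q)
                      ∷ (n∣m*n p , ¬prime-* 2≤q 2≤Q)
                      ∷ []

Π+n<𝒞⇒X<0 : ∀ n → Π n + n ℕ.< 𝒞 n → X n < + 0
Π+n<𝒞⇒X<0 n Π+n<𝒞 = begin-strict
  + Π n - + 𝒞 n ℤ.+ + n    ≡⟨ rearrange (+ Π n) (+ 𝒞 n) (+ n) ⟩
  + Π n ℤ.+ + n - + 𝒞 n    ≡⟨ cong (_- + 𝒞 n) (ℤ.pos-+ (Π n) n) ⟨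
  + (Π n + n) - + 𝒞 n      <⟨ ℤ.+-monoˡ-< (ℤ.- + 𝒞 n) (+<+ Π+n<𝒞) ⟩
  + 𝒞 n - + 𝒞 n            ≡⟨ ℤ.+-inverseʳ (+ 𝒞 n) ⟩
  + 0                      ∎
  where
  open ℤ.≤-Reasoning
  rearrange : ∀ a b c → a - b ℤ.+ c ≡ a ℤ.+ c - b
  rearrange = ℤ-Solver.solve-∀

X<0⇒¬Survivor : ∀ {n} → X n < + 0 → ¬ Survivor n
X<0⇒¬Survivor X<0 survivor = ℤ.<-asym X<0 (survivor 1 (s≤s z≤n))

lemma1 : (N : ℕ) → N ≥ 3 → (ps : List ℕ) → length ps ≡ N → All Prime ps → Unique ps →
         (n : ℕ) → n ≡ product ps → (X n < + 0) × ¬ Survivor n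
lemma1 _ ()              []           refl
lemma1 _ (s≤s ())        (_ ∷ [])     refl
lemma1 _ (s≤s (s≤s ()))  (_ ∷ _ ∷ []) refl
lemma1 _ _ ps@(_ ∷ _ ∷ _ ∷ _) _ ps-prime ((p≢q ∷ _) ∷ _) _ refl = X<0 , X<0⇒¬Survivor X<0
  where
  X<0 : X (product ps) < + 0
  X<0 = Π+n<𝒞⇒X<0 (product ps) (Π+n<𝒞 ps-prime p≢q)
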